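{- Let $p$ be a pebble distribution on a graph $G$, let $v$ be a vertex of degree $2$ with $p(v)\ge 3$, and let $q$ be obtained from $p$ by a smoothing move from $v$. If a vertex $u$ is $2$-reachable under $p$, then $u$ is $2$-reachable under $q$.
   Context: A pebble distribution on $G$ is a function $p:V(G)\to\mathbb{Z}_{\ge0}$. A smoothing move from a degree-2 vertex $v$ with $p(v)\ge 3$ removes two pebbles from $v$ and adds one pebble at each of the two neighbours of $v$. A pebbling move along an edge $\{v,u\}$ removes two pebbles from $v$ and adds one at $u$; a strict rubbling move $(v,w\to u)$ with $v\neq w$ both adjacent to $u$ removes one pebble from each of $v,w$ and adds one at $u$; rubbling moves are either kind. A sequence of rubbling moves is executable if pebble counts stay nonnegative throughout. A vertex $u$ is $2$-reachable under $p$ if some executable sequence ends with at least $2$ pebbles on $u$. -}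

module Defs where

open import Level using (0ℓ)
open import Data.Nat using (ℕ; zero; suc; _+_; _∸_; _≤_)
open import Data.Fin using (Fin; _≟_)
open import Data.Product using (_×_; ∃-syntax; _,_)
open import Data.Sum using (_⊎_)
open import Relation.Nullary using (¬_; yes; no)
open import Relation.Binary.PropositionalEquality using (_≡_)

record Graph (n : ℕ) : Set₁ where
  field
    Adj     : Fin n → Fin n → Set
    sym     : ∀ {x y} → Adj x y → Adj y x
    irrefl  : ∀ {x} → ¬ Adj x x
open Graph public

Dist : ℕ → Set
Dist n = Fin n → ℕ

addOne : ∀ {n} → Fin n → Dist n → Dist n
addOne u p x with x ≟ u
... | yes _ = suc (p x)
... | no  _ = p x

-- remove k pebbles at v (truncated; only used when p v ≥ k)
remove : ∀ {n} → ℕ → Fin n → Dist n → Dist n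
remove k v p x with x ≟ v
... | yes _ = p x ∸ k
... | no  _ = p x

HasDegree2 : ∀ {n} → Graph n → Fin n → Fin n → Fin n → Set
HasDegree2 G v a b =
  Adj G v a × Adj G v b × ¬ (a ≡ b) × (∀ w → Adj G v w → (w ≡ a ⊎ w ≡ b))

smooth : ∀ {n} → Fin n → Fin n → Fin n → Dist n → Dist n
smooth v a b p = addOne b (addOne a (remove 2 v p))

data Move {n} (G : Graph n) : Dist n → Dist n → Set where
  pebbling : ∀ {p} v u → Adj G v u → 2 ≤ p v →
             Move G p (addOne u (remove 2 v p))
  strictRubbling : ∀ {p} v w u → ¬ (v ≡ w) → Adj G v u → Adj G w u →
             1 ≤ p v → 1 ≤ p w →
             Move G p (addOne u (remove 1 w (remove 1 v p)))

data Reach {n} (G : Graph n) : Dist n → Dist n → Set where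
  done : ∀ {p} → Reach G p p
  step : ∀ {p q r} → Move G p q → Reach G q r → Reach G p r

TwoReachable : ∀ {n} → Graph n → Dist n → Fin n → Set
TwoReachable G p u = ∃[ q ] (Reach G p q × 2 ≤ q u)

module Submission where

-- Let q be p smoothed at the degree-2 vertex v with neighbours a, b.  If
-- u = v, the rubbling move (a, b → v) from q leaves p(v) - 1 ≥ 2 pebbles
-- on v.  If u ≠ v, q simulates any executable sequence from p while
-- keeping a "debt": q covers p except that it owes one or two pebbles at
-- v, backed by credit pebbles elsewhere (initially at a and b).  When p
-- spends pebbles of v, q answers with at most one move and the debt
-- shrinks; other moves are copied.  At the end q dominates p off v.

open import Defs
open import Data.Nat using (ℕ; _+_; _*_; _∸_; _≤_; z≤n)
open import Data.Nat.Properties hiding (_≟_)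
open import Data.Nat.Tactic.RingSolver using (solve-∀)
open import Data.Fin using (Fin; _≟_)
open import Data.Product using (_×_; _,_; ∃-syntax)
open import Data.Sum using (_⊎_; inj₁; inj₂; swap)
open import Data.Empty using (⊥-elim)
open import Relation.Nullary using (¬_; yes; no)
open import Relation.Binary.PropositionalEquality as ≡
  using (_≡_; refl; cong; cong₂; subst; trans)

-- 𝟙 x y counts the copies of x at the point y; 𝟙₂ x z is the indicator of
-- the multiset {x, z}.  Costs and gains of moves are expressed with them.
𝟙 : ∀ {n} → Fin n → Fin n → ℕ
𝟙 x y with y ≟ x
... | yes _ = 1
... | no  _ = 0

𝟙₂ : ∀ {n} → Fin n → Fin n → Fin n → ℕ
𝟙₂ x z y = 𝟙 x y + 𝟙 z y

none : ∀ {n} → Fin n → ℕ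
none _ = 0

𝟙-self : ∀ {n} (x : Fin n) → 𝟙 x x ≡ 1
𝟙-self x with x ≟ x
... | yes _   = refl
... | no  x≢x = ⊥-elim (x≢x refl)

𝟙-other : ∀ {n} {x y : Fin n} → ¬ y ≡ x → 𝟙 x y ≡ 0
𝟙-other {x = x} {y} y≢x with y ≟ x
... | yes y≡x = ⊥-elim (y≢x y≡x)
... | no  _   = refl

𝟙₂-other : ∀ {n} {x z y : Fin n} → ¬ y ≡ x → ¬ y ≡ z → 𝟙₂ x z y ≡ 0
𝟙₂-other y≢x y≢z = cong₂ _+_ (𝟙-other y≢x) (𝟙-other y≢z)

record Balance {n} (p p' : Dist n) (c g : Fin n → ℕ) : Set where
  constructor balanced
  field balance-at : ∀ y → p' y + c y ≡ p y + g y
open Balance public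

record Covers {n} (d e : Fin n → ℕ) (p q : Dist n) : Set where
  constructor covering
  field covers-at : ∀ y → p y + d y ≤ q y + e y
open Covers public

unmoved : ∀ {n} {q : Dist n} → Balance q q none none
unmoved = balanced λ _ → refl

covers-off : ∀ {n} {d e : Fin n → ℕ} {p q : Dist n} → Covers d e p q →
             ∀ y → e y ≡ 0 → p y ≤ q y
covers-off {d = d} {e} {p} {q} cover y e≡0 =
  ≤-trans (m≤m+n (p y) (d y))
    (subst (p y + d y ≤_) (trans (cong (q y +_) e≡0) (+-identityʳ (q y))) (covers-at cover y))

transfer : ∀ {n} {p p' q q' : Dist n} {cp gp cq gq d e d' e' : Fin n → ℕ} →
           Balance p p' cp gp → Balance q q' cq gq →
           (∀ y → gp y + d' y + cq y + e y ≤ gq y + e' y + cp y + d y) →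
           Covers d e p q → Covers d' e' p' q'
transfer {p = P} {P'} {Q} {Q'} {CP} {GP} {CQ} {GQ} {D} {E} {D'} {E'} bal-p bal-q slack cover =
  covering λ y → let
    p = P y ; p' = P' y ; q = Q y ; q' = Q' y ; cp = CP y ; gp = GP y
    cq = CQ y ; gq = GQ y ; d = D y ; e = E y ; d' = D' y ; e' = E' y
    open ≤-Reasoning
    in +-cancelʳ-≤ (cp + cq + d + e) (p' + d') (q' + e') (begin
      p' + d' + (cp + cq + d + e)     ≡⟨ rearrange₁ p' d' cp cq d e ⟩
      (p' + cp) + (d' + cq + d + e)   ≡⟨ cong (_+ (d' + cq + d + e)) (balance-at bal-p y) ⟩
      (p + gp) + (d' + cq + d + e)    ≡⟨ rearrange₂ p gp d' cq d e ⟩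
      (p + d) + (gp + d' + cq + e)    ≤⟨ +-mono-≤ (covers-at cover y) (slack y) ⟩
      (q + e) + (gq + e' + cp + d)    ≡⟨ rearrange₃ q e gq e' cp d ⟩
      (q + gq) + (e' + cp + d + e)    ≡⟨ cong (_+ (e' + cp + d + e)) (≡.sym (balance-at bal-q y)) ⟩
      (q' + cq) + (e' + cp + d + e)   ≡⟨ rearrange₄ q' cq e' cp d e ⟩
      q' + e' + (cp + cq + d + e)     ∎)
  where
  rearrange₁ : ∀ p' d' cp cq d e → p' + d' + (cp + cq + d + e) ≡ (p' + cp) + (d' + cq + d + e)
  rearrange₁ = solve-∀
  rearrange₂ : ∀ p gp d' cq d e → (p + gp) + (d' + cq + d + e) ≡ (p + d) + (gp + d' + cq + e)
  rearrange₂ = solve-∀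
  rearrange₃ : ∀ q e gq e' cp d → (q + e) + (gq + e' + cp + d) ≡ (q + gq) + (e' + cp + d + e)
  rearrange₃ = solve-∀
  rearrange₄ : ∀ q' cq e' cp d e → (q' + cq) + (e' + cp + d + e) ≡ q' + e' + (cp + cq + d + e)
  rearrange₄ = solve-∀

addOne-balance : ∀ {n} (u : Fin n) (p : Dist n) y → addOne u p y ≡ p y + 𝟙 u y
addOne-balance u p y with y ≟ u
... | yes _ = +-comm 1 (p y)
... | no  _ = ≡.sym (+-identityʳ (p y))

remove-balance : ∀ {n} k (x : Fin n) (p : Dist n) → k ≤ p x →
                 ∀ y → remove k x p y + k * 𝟙 x y ≡ p y
remove-balance k x p k≤px y with y ≟ x
... | yes refl = trans (cong (p y ∸ k +_) (*-identityʳ k)) (m∸n+n≡m k≤px)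
... | no  _    = trans (cong (p y +_) (*-zeroʳ k)) (+-identityʳ (p y))

remove-other : ∀ {n} k {x y : Fin n} (p : Dist n) → ¬ y ≡ x → remove k x p y ≡ p y
remove-other k {x} {y} p y≢x with y ≟ x
... | yes y≡x = ⊥-elim (y≢x y≡x)
... | no  _   = refl

smooth-balance : ∀ {n} (v a b : Fin n) (p : Dist n) → 2 ≤ p v →
                 Balance p (smooth v a b p) (𝟙₂ v v) (𝟙₂ a b)
smooth-balance v a b p 2≤pv = balanced λ y → begin
  addOne b (addOne a R) y + (𝟙 v y + 𝟙 v y)   ≡⟨ cong (_+ (𝟙 v y + 𝟙 v y)) (addOne-balance b (addOne a R) y) ⟩
  addOne a R y + 𝟙 b y + (𝟙 v y + 𝟙 v y)      ≡⟨ cong (λ k → k + 𝟙 b y + (𝟙 v y + 𝟙 v y)) (addOne-balance a R y) ⟩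
  R y + 𝟙 a y + 𝟙 b y + (𝟙 v y + 𝟙 v y)      ≡⟨ regroup (R y) (𝟙 a y) (𝟙 b y) (𝟙 v y) ⟩
  R y + 2 * 𝟙 v y + (𝟙 a y + 𝟙 b y)          ≡⟨ cong (_+ (𝟙 a y + 𝟙 b y)) (remove-balance 2 v p 2≤pv y) ⟩
  p y + (𝟙 a y + 𝟙 b y)                      ∎
  where
  open ≡.≡-Reasoning
  R = remove 2 v p
  regroup : ∀ r i j k → r + i + j + (k + k) ≡ r + 2 * k + (i + j)
  regroup = solve-∀

adj-distinct : ∀ {n} (G : Graph n) {x y} → Adj G x y → ¬ x ≡ y
adj-distinct G xy refl = Graph.irrefl G xy

neighbours : ∀ {n} (G : Graph n) {v a b t} → HasDegree2 G v a b → Adj G v t → t ≡ a ⊎ t ≡ b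
neighbours G (_ , _ , _ , only) vt = only _ vt

degree2-swap : ∀ {n} (G : Graph n) {v a b} → HasDegree2 G v a b → HasDegree2 G v b a
degree2-swap G (va , vb , a≢b , only) =
  vb , va , (λ b≡a → a≢b (≡.sym b≡a)) , λ t vt → swap (only t vt)

other-neighbour : ∀ {n} (G : Graph n) {v a b t} → HasDegree2 G v a b → Adj G v t →
                  ∃[ t' ] (HasDegree2 G v t t' × ∀ y → 𝟙₂ t t' y ≡ 𝟙₂ a b y)
other-neighbour G {a = a} {b} deg vt with neighbours G deg vt
... | inj₁ refl = b , deg , λ _ → refl
... | inj₂ refl = a , degree2-swap G deg , λ y → +-comm (𝟙 b y) (𝟙 a y)

module Moves {n} (G : Graph n) where

  -- A move from p to p' gathers one pebble from each of the sources x, z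
  -- (two from x if x = z) onto t, a common neighbour of the sources.
  record Gathers (p p' : Dist n) (x z t : Fin n) : Set where
    field
      adj₁       : Adj G x t
      adj₂       : Adj G z t
      affordable : ∀ y → 𝟙₂ x z y ≤ p y
      balance    : Balance p p' (𝟙₂ x z) (𝟙 t)
  open Gathers public

  pebbling-gathers : ∀ {p} x t → Adj G x t → 2 ≤ p x →
                     Gathers p (addOne t (remove 2 x p)) x x t
  pebbling-gathers {p} x t xt 2≤px = record
    { adj₁ = xt ; adj₂ = xt ; affordable = afford ; balance = balanced bal }
    where
    afford : ∀ y → 𝟙₂ x x y ≤ p y
    afford y with y ≟ x
    ... | yes refl = 2≤px
    ... | no  _    = z≤n
    open ≡.≡-Reasoning
    R = remove 2 x p
    regroup : ∀ r i j → r + j + (i + i) ≡ r + 2 * i + j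
    regroup = solve-∀
    bal : ∀ y → addOne t R y + 𝟙₂ x x y ≡ p y + 𝟙 t y
    bal y = begin
      addOne t R y + (𝟙 x y + 𝟙 x y)   ≡⟨ cong (_+ (𝟙 x y + 𝟙 x y)) (addOne-balance t R y) ⟩
      R y + 𝟙 t y + (𝟙 x y + 𝟙 x y)   ≡⟨ regroup (R y) (𝟙 x y) (𝟙 t y) ⟩
      R y + 2 * 𝟙 x y + 𝟙 t y         ≡⟨ cong (_+ 𝟙 t y) (remove-balance 2 x p 2≤px y) ⟩
      p y + 𝟙 t y                     ∎

  rubbling-gathers : ∀ {p} x z t → ¬ x ≡ z → Adj G x t → Adj G z t → 1 ≤ p x → 1 ≤ p z →
                     Gathers p (addOne t (remove 1 z (remove 1 x p))) x z t
  rubbling-gathers {p} x z t x≢z xt zt 1≤px 1≤pz = record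
    { adj₁ = xt ; adj₂ = zt ; affordable = afford ; balance = balanced bal }
    where
    afford : ∀ y → 𝟙₂ x z y ≤ p y
    afford y with y ≟ x | y ≟ z
    ... | yes refl | yes refl = ⊥-elim (x≢z refl)
    ... | yes refl | no  _    = 1≤px
    ... | no  _    | yes refl = 1≤pz
    ... | no  _    | no  _    = z≤n
    open ≡.≡-Reasoning
    R₁ = remove 1 x p
    R₂ = remove 1 z R₁
    1≤R₁z : 1 ≤ R₁ z
    1≤R₁z = subst (1 ≤_) (≡.sym (remove-other 1 p (λ z≡x → x≢z (≡.sym z≡x)))) 1≤pz
    regroup : ∀ r i j k → r + k + (i + j) ≡ r + 1 * j + 1 * i + k
    regroup = solve-∀
    bal : ∀ y → addOne t R₂ y + 𝟙₂ x z y ≡ p y + 𝟙 t y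
    bal y = begin
      addOne t R₂ y + (𝟙 x y + 𝟙 z y)          ≡⟨ cong (_+ (𝟙 x y + 𝟙 z y)) (addOne-balance t R₂ y) ⟩
      R₂ y + 𝟙 t y + (𝟙 x y + 𝟙 z y)          ≡⟨ regroup (R₂ y) (𝟙 x y) (𝟙 z y) (𝟙 t y) ⟩
      R₂ y + 1 * 𝟙 z y + 1 * 𝟙 x y + 𝟙 t y    ≡⟨ cong (λ k → k + 1 * 𝟙 x y + 𝟙 t y) (remove-balance 1 z R₁ 1≤R₁z y) ⟩
      R₁ y + 1 * 𝟙 x y + 𝟙 t y                ≡⟨ cong (_+ 𝟙 t y) (remove-balance 1 x p 1≤px y) ⟩
      p y + 𝟙 t y                             ∎

  move-gathers : ∀ {p p'} → Move G p p' → ∃[ x ] ∃[ z ] ∃[ t ] Gathers p p' x z t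
  move-gathers (pebbling x t xt 2≤px) = x , x , t , pebbling-gathers x t xt 2≤px
  move-gathers (strictRubbling x z t x≢z xt zt 1≤px 1≤pz) =
    x , z , t , rubbling-gathers x z t x≢z xt zt 1≤px 1≤pz

  gather : ∀ {q x z t} → Adj G x t → Adj G z t → (∀ y → 𝟙₂ x z y ≤ q y) →
           ∃[ q' ] (Move G q q' × Gathers q q' x z t)
  gather {q} {x} {z} {t} xt zt afford with x ≟ z
  ... | yes refl = _ , pebbling x t xt 2≤qx , pebbling-gathers x t xt 2≤qx
    where
    2≤qx : 2 ≤ q x
    2≤qx = subst (_≤ q x) (cong₂ _+_ (𝟙-self x) (𝟙-self x)) (afford x)
  ... | no x≢z = _ , strictRubbling x z t x≢z xt zt 1≤qx 1≤qz ,
                 rubbling-gathers x z t x≢z xt zt 1≤qx 1≤qz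
    where
    1≤qx : 1 ≤ q x
    1≤qx = m+n≤o⇒m≤o 1 (subst (λ k → k + 𝟙 z x ≤ q x) (𝟙-self x) (afford x))
    1≤qz : 1 ≤ q z
    1≤qz = m+n≤o⇒n≤o (𝟙 x z) (subst (λ k → 𝟙 x z + k ≤ q z) (𝟙-self z) (afford z))

  gathers-swap : ∀ {p p' x z t} → Gathers p p' x z t → Gathers p p' z x t
  gathers-swap {p} {p'} {x} {z} g = record
    { adj₁ = adj₂ g ; adj₂ = adj₁ g
    ; affordable = λ y → subst (_≤ p y) (+-comm (𝟙 x y) (𝟙 z y)) (affordable g y)
    ; balance = balanced λ y →
        trans (cong (p' y +_) (+-comm (𝟙 z y) (𝟙 x y))) (balance-at (balance g) y) }

  replay-covers : ∀ {p p' q x z t} {d e : Fin n → ℕ} → Gathers p p' x z t →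
                  (∀ y → 𝟙₂ x z y ≤ q y) → Covers d e p q →
                  ∃[ q' ] (Move G q q' × Covers d e p' q')
  replay-covers {x = x} {z} {t} {d} {e} g afford cover with gather (adj₁ g) (adj₂ g) afford
  ... | q' , m , g' = q' , m , transfer (balance g) (balance g') same-move cover
    where
    regroup : ∀ i j k l → i + j + k + l ≡ i + l + k + j
    regroup = solve-∀
    same-move : ∀ y → 𝟙 t y + d y + 𝟙₂ x z y + e y ≤ 𝟙 t y + e y + 𝟙₂ x z y + d y
    same-move y = ≤-reflexive (regroup (𝟙 t y) (d y) (𝟙₂ x z y) (e y))

  _◅◅_ : ∀ {p q r} → Reach G p q → Reach G q r → Reach G p r
  done        ◅◅ rest = rest
  step m more ◅◅ rest = step m (more ◅◅ rest)

  Simulation : (Dist n → Dist n → Set) → Set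
  Simulation R = ∀ {p p' q} → R p q → Move G p p' → ∃[ q' ] (Reach G q q' × R p' q')

  simulate : ∀ {R p q r} → Simulation R → R p q → Reach G p r →
             ∃[ s ] (Reach G q s × R r s)
  simulate sim rel done = _ , done , rel
  simulate sim rel (step m rest) with sim rel m
  ... | q' , q↝q' , rel' with simulate sim rel' rest
  ...   | s , q'↝s , relₛ = s , q↝q' ◅◅ q'↝s , relₛ

≤-by-slack : ∀ {m n} k → m + k ≡ n → m ≤ n
≤-by-slack {m} k m+k≡n = subst (m ≤_) m+k≡n (m≤m+n m k)

-- Slack inequalities for the three ways q settles a debt (see below);
-- in each, the variables stand for the indicator values at one point.
two-to-one-slack : ∀ t t' a b z v → t + t' ≡ a + b →
                   t + (z + t') + 0 + (v + v) ≤ 0 + v + (v + z) + (a + b)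
two-to-one-slack t t' a b z v t+t'≡a+b = ≤-reflexive (begin
  t + (z + t') + 0 + (v + v)   ≡⟨ regroup₁ t t' z v ⟩
  (t + t') + (z + (v + v))     ≡⟨ cong (_+ (z + (v + v))) t+t'≡a+b ⟩
  (a + b) + (z + (v + v))      ≡⟨ regroup₂ a b z v ⟩
  0 + v + (v + z) + (a + b)    ∎)
  where
  open ≡.≡-Reasoning
  regroup₁ : ∀ t t' z v → t + (z + t') + 0 + (v + v) ≡ (t + t') + (z + (v + v))
  regroup₁ = solve-∀
  regroup₂ : ∀ a b z v → (a + b) + (z + (v + v)) ≡ 0 + v + (v + z) + (a + b)
  regroup₂ = solve-∀

one-idle-slack : ∀ c' v z w → c' + 0 + 0 + v ≤ 0 + 0 + (v + z) + (w + c')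
one-idle-slack c' v z w = ≤-by-slack (z + w) (regroup c' v z w)
  where
  regroup : ∀ c' v z w → c' + 0 + 0 + v + (z + w) ≡ 0 + 0 + (v + z) + (w + c')
  regroup = solve-∀

one-gather-slack : ∀ c v z w c' → c + 0 + (w + z) + v ≤ c + 0 + (v + z) + (w + c')
one-gather-slack c v z w c' = ≤-by-slack c' (regroup c v z w c')
  where
  regroup : ∀ c v z w c' → c + 0 + (w + z) + v + c' ≡ c + 0 + (v + z) + (w + c')
  regroup = solve-∀

credit-pays : ∀ {v z w c' P Q} → v + z ≤ P → P + (w + c') ≤ Q + v → w + z ≤ Q
credit-pays {v} {z} {w} {c'} {P} {Q} v+z≤P cover = +-cancelʳ-≤ v (w + z) Q (begin
  w + z + v          ≡⟨ regroup w z v ⟩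
  v + z + w          ≤⟨ +-monoˡ-≤ w v+z≤P ⟩
  P + w              ≤⟨ +-monoʳ-≤ P (m≤m+n w c') ⟩
  P + (w + c')       ≤⟨ cover ⟩
  Q + v              ∎)
  where
  open ≤-Reasoning
  regroup : ∀ w z v → w + z + v ≡ v + z + w
  regroup = solve-∀

module Debts {n} (G : Graph n) (v : Fin n) where
  open Moves G

  -- The ways q may fall behind p at v: it owes one or two pebbles at v
  -- and holds, as credit, pebbles at the listed vertices instead.
  data Owing : (credit owed : Fin n → ℕ) → Set where
    nothing-owed : Owing none none
    owes-one     : ∀ {c c'} w → HasDegree2 G v c c' → Adj G w c → Owing (𝟙₂ w c') (𝟙 v)
    owes-two     : ∀ {a b} → HasDegree2 G v a b → Owing (𝟙₂ a b) (𝟙₂ v v)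

  record Debt (p q : Dist n) : Set where
    constructor debt
    field
      {credit owed} : Fin n → ℕ
      owing         : Owing credit owed
      cover         : Covers credit owed p q

  owed-only-at-v : ∀ {d e} → Owing d e → ∀ y → ¬ y ≡ v → e y ≡ 0
  owed-only-at-v nothing-owed    y y≢v = refl
  owed-only-at-v (owes-one _ _ _) y y≢v = 𝟙-other y≢v
  owed-only-at-v (owes-two _)     y y≢v = 𝟙₂-other y≢v y≢v

  debt-dominates : ∀ {p q} → Debt p q → ∀ y → ¬ y ≡ v → p y ≤ q y
  debt-dominates (debt owing cover) y y≢v = covers-off cover y (owed-only-at-v owing y y≢v)

  replay : ∀ {p p' q x z t} → Debt p q → Gathers p p' x z t → (∀ y → 𝟙₂ x z y ≤ q y) →
           ∃[ q' ] (Reach G q q' × Debt p' q')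
  replay (debt owing cover) g afford with replay-covers g afford cover
  ... | q' , m , cover' = q' , step m done , debt owing cover'

  away-affordable : ∀ {p p' q x z t} → Debt p q → Gathers p p' x z t →
                    ¬ x ≡ v → ¬ z ≡ v → ∀ y → 𝟙₂ x z y ≤ q y
  away-affordable {q = q} d g x≢v z≢v y with y ≟ v
  ... | yes refl = subst (_≤ q y) (≡.sym (𝟙₂-other (λ v≡x → x≢v (≡.sym v≡x))
                                                  (λ v≡z → z≢v (≡.sym v≡z)))) z≤n
  ... | no  y≢v  = ≤-trans (affordable g y) (debt-dominates d y y≢v)

  data Role (p p' : Dist n) : Set where
    away  : ∀ {x z t} → Gathers p p' x z t → ¬ x ≡ v → ¬ z ≡ v → Role p p'
    fromV : ∀ {z t} → Gathers p p' v z t → Role p p'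

  role : ∀ {p p'} → Move G p p' → Role p p'
  role m with move-gathers m
  ... | x , z , t , g with x ≟ v | z ≟ v
  ...   | yes refl | _        = fromV g
  ...   | no  _    | yes refl = fromV (gathers-swap g)
  ...   | no  x≢v  | no  z≢v  = away g x≢v z≢v

  -- Owing two: when p gathers from v (and z) onto t, q stays put; it now
  -- owes one pebble, backed by z and by the other neighbour t' of v.
  spend-two : ∀ {p p' q a b z t} → HasDegree2 G v a b → Covers (𝟙₂ a b) (𝟙₂ v v) p q →
              Gathers p p' v z t → Debt p' q
  spend-two {a = a} {b} {z} {t} deg cover g with other-neighbour G deg (adj₁ g)
  ... | t' , deg' , pair≡ = debt (owes-one z deg' (adj₂ g)) (transfer (balance g) unmoved
          (λ y → two-to-one-slack (𝟙 t y) (𝟙 t' y) (𝟙 a y) (𝟙 b y) (𝟙 z y) (𝟙 v y) (pair≡ y)) cover)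

  -- Owing one, backed by w next to c: if p gathers onto c then q gathers
  -- the credit w and p's second source z onto c; if onto the other
  -- neighbour c', q stays put.  Either way the debt is settled.
  spend-one : ∀ {p p' q c c' w z t} → HasDegree2 G v c c' → Adj G w c →
              Covers (𝟙₂ w c') (𝟙 v) p q → Gathers p p' v z t →
              ∃[ q' ] (Reach G q q' × Debt p' q')
  spend-one {p} {q = q} {c} {c'} {w} {z} {t} deg wc cover g with neighbours G deg (adj₁ g)
  ... | inj₁ refl =
    let q' , m , g' = gather wc (adj₂ g) credit-affords
    in q' , step m done , debt nothing-owed (transfer (balance g) (balance g')
         (λ y → one-gather-slack (𝟙 c y) (𝟙 v y) (𝟙 z y) (𝟙 w y) (𝟙 c' y)) cover)
    where
    credit-affords : ∀ y → 𝟙₂ w z y ≤ q y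
    credit-affords y = credit-pays {𝟙 v y} (affordable g y) (covers-at cover y)
  spend-one {c' = c'} {w} {z} deg wc cover g | inj₂ refl =
    _ , done , debt nothing-owed (transfer (balance g) unmoved
      (λ y → one-idle-slack (𝟙 c' y) (𝟙 v y) (𝟙 z y) (𝟙 w y)) cover)

  answer : ∀ {p p' q z t} → Debt p q → Gathers p p' v z t → ∃[ q' ] (Reach G q q' × Debt p' q')
  answer d@(debt nothing-owed cover) g =
    replay d g λ y → ≤-trans (affordable g y) (covers-off cover y refl)
  answer (debt (owes-one w deg wc) cover) g = spend-one deg wc cover g
  answer (debt (owes-two deg) cover) g = _ , done , spend-two deg cover g

  debt-simulation : Simulation Debt
  debt-simulation d m with role m
  ... | away g x≢v z≢v = replay d g (away-affordable d g x≢v z≢v)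
  ... | fromV g        = answer d g

  smoothing-debt : ∀ {p a b} → HasDegree2 G v a b → 2 ≤ p v → Debt p (smooth v a b p)
  smoothing-debt {p} {a} {b} deg 2≤pv = debt (owes-two deg)
    (covering λ y → ≤-reflexive (≡.sym (balance-at (smooth-balance v a b p 2≤pv) y)))

gain-≤ : ∀ {Q P c g} → Q + c ≡ P + g → c ≡ 0 → g ≤ Q
gain-≤ {Q} {P} {g = g} balanced-here refl = begin
  g        ≤⟨ m≤n+m g P ⟩
  P + g    ≡⟨ ≡.sym balanced-here ⟩
  Q + 0    ≡⟨ +-identityʳ Q ⟩
  Q        ∎
  where open ≤-Reasoning

-- Counting at v: smoothing leaves Q = P - 2 and gathering onto v gives
-- Q' = Q + 1, which is at least 2 when P ≥ 3.
refill-count : ∀ {Q' Q P i k} → Q' + i ≡ Q + k → Q + (k + k) ≡ P + i →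
               i ≡ 0 → k ≡ 1 → 3 ≤ P → 2 ≤ Q'
refill-count {Q'} {Q} {P} gathered smoothed refl refl 3≤P = +-cancelʳ-≤ 1 2 Q' (begin
  3           ≤⟨ 3≤P ⟩
  P           ≡⟨ ≡.sym (+-identityʳ P) ⟩
  P + 0       ≡⟨ ≡.sym smoothed ⟩
  Q + 2       ≡⟨ ≡.sym (+-assoc Q 1 1) ⟩
  Q + 1 + 1   ≡⟨ cong (_+ 1) (≡.sym gathered) ⟩
  Q' + 0 + 1  ≡⟨ cong (_+ 1) (+-identityʳ Q') ⟩
  Q' + 1      ∎)
  where open ≤-Reasoning

refill : ∀ {n} (G : Graph n) {p v a b} → HasDegree2 G v a b → 3 ≤ p v →
         TwoReachable G (smooth v a b p) v
refill G {p} {v} {a} {b} deg@(va , vb , _ , _) 3≤pv =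
  let q' , m , g' = gather (Graph.sym G va) (Graph.sym G vb) afford
  in q' , step m done ,
     refill-count (balance-at (balance g') v) (balance-at smoothing v) a,b∉v (𝟙-self v) 3≤pv
  where
  open Moves G
  smoothing = smooth-balance v a b p (≤-trans (n≤1+n 2) 3≤pv)
  a,b∉v : 𝟙₂ a b v ≡ 0
  a,b∉v = 𝟙₂-other (adj-distinct G va) (adj-distinct G vb)
  afford : ∀ y → 𝟙₂ a b y ≤ smooth v a b p y
  afford y with y ≟ v
  ... | yes refl = subst (_≤ smooth v a b p v) (≡.sym a,b∉v) z≤n
  ... | no  y≢v  = gain-≤ {P = p y} (balance-at smoothing y) (𝟙₂-other y≢v y≢v)

lemma12 : ∀ {n} (G : Graph n) (p : Dist n) (v a b u : Fin n) →
          HasDegree2 G v a b → 3 ≤ p v →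
          TwoReachable G p u → TwoReachable G (smooth v a b p) u
lemma12 G p v a b u deg 3≤pv (r , p↝r , 2≤ru) with u ≟ v
... | yes refl = refill G deg 3≤pv
... | no  u≢v  =
  let s , q↝s , debt-rs = simulate debt-simulation (smoothing-debt deg (≤-trans (n≤1+n 2) 3≤pv)) p↝r
  in s , q↝s , ≤-trans 2≤ru (debt-dominates debt-rs u u≢v)
  where
  open Moves G
  open Debts G v
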